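{- Let $G$ be a very well-covered graph, let $B\in\Psi(G)$, let $v\in V(G)-B$, and suppose $A=B\cup\{v\}$ is a stable set of $G$. Then $A\in\Psi(G)$ if and only if $|N(A)|=|N(B)|+1$.
   Context: All graphs are finite and simple. For $X\subseteq V(G)$, $N(X)=\{u\in V(G)-X: N(u)\cap X\neq\emptyset\}$ and $N[X]=X\cup N(X)$. $\alpha(G)$ is the maximum size of a stable set. $G$ is well-covered if all maximal stable sets have the same size; very well-covered if moreover it has no isolated vertices and $|V(G)|=2\alpha(G)$. $S\subseteq V(G)$ is a local maximum stable set if $S$ is a maximum stable set of the induced subgraph $G[N[S]]$; $\Psi(G)$ is the family of all local maximum stable sets of $G$. -}

module Defs where

open import Data.Nat using (ℕ; _≤_; _*_)
open import Data.Bool using (Bool; true; false; not; _∧_; _∨_)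
open import Data.Fin using (Fin)
open import Data.Fin.Subset using (Subset; _∈_; _∉_; _⊆_; _∪_; ⁅_⁆; ∣_∣; ⊤)
open import Data.Vec using (lookup; tabulate; foldr′)
open import Data.Product using (Σ; ∃; _×_; _,_)
open import Relation.Binary.PropositionalEquality using (_≡_)
open import Relation.Nullary using (¬_)

record Graph (n : ℕ) : Set where
  field
    adj    : Fin n → Fin n → Bool
    sym    : ∀ x y → adj x y ≡ adj y x
    irrefl : ∀ x → adj x x ≡ false
open Graph public

Adj : ∀ {n} → Graph n → Fin n → Fin n → Set
Adj G x y = adj G x y ≡ true

Stable : ∀ {n} → Graph n → Subset n → Set
Stable G S = ∀ x y → x ∈ S → y ∈ S → ¬ Adj G x y

hasNbrIn : ∀ {n} → Graph n → Subset n → Fin n → Bool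
hasNbrIn {n} G X u = foldr′ _∨_ false (tabulate (λ w → lookup X w ∧ adj G u w))

N : ∀ {n} → Graph n → Subset n → Subset n
N G X = tabulate (λ u → not (lookup X u) ∧ hasNbrIn G X u)

N[_] : ∀ {n} → Graph n → Subset n → Subset n
N[ G ] X = X ∪ N G X

-- S is a maximum stable set of the induced subgraph G[W].
-- (Stability in G[W] of a subset of W coincides with stability in G.)
MaxStableIn : ∀ {n} → Graph n → Subset n → Subset n → Set
MaxStableIn G W S =
  S ⊆ W × Stable G S × (∀ T → T ⊆ W → Stable G T → ∣ T ∣ ≤ ∣ S ∣)

MaximumStable : ∀ {n} → Graph n → Subset n → Set
MaximumStable G S = MaxStableIn G ⊤ S

MaximalStable : ∀ {n} → Graph n → Subset n → Set
MaximalStable G S = Stable G S × (∀ T → Stable G T → S ⊆ T → T ⊆ S)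

WellCovered : ∀ {n} → Graph n → Set
WellCovered G = ∀ S T → MaximalStable G S → MaximalStable G T → ∣ S ∣ ≡ ∣ T ∣

NoIsolated : ∀ {n} → Graph n → Set
NoIsolated G = ∀ x → ∃ λ y → Adj G x y

-- |V(G)| = 2 α(G): there is a maximum stable set S with n = 2 |S|.
VeryWellCovered : ∀ {n} → Graph n → Set
VeryWellCovered {n} G =
  WellCovered G × NoIsolated G × (Σ (Subset n) λ S → MaximumStable G S × n ≡ 2 * ∣ S ∣)

-- S ∈ Ψ(G): S is a maximum stable set of G[N[S]].
LocalMax : ∀ {n} → Graph n → Subset n → Set
LocalMax G S = MaxStableIn G (N[ G ] S) S

module Submission where

-- In a very well-covered graph G (well-covered, no isolated vertices, |V| = 2α(G)),
-- a stable set S is a local maximum stable set iff |N(S)| = |S|  (localMax⇔).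
-- lemma2 follows at once: for A = B ∪ {v} with B ∈ Ψ(G) and v ∉ B we have
-- |A| = |B| + 1 and |N(B)| = |B|.
--
-- The characterisation rests on three facts about well-covered graphs.
-- * Exchange lemma: for stable P, S₀ ⊆ P and y ∈ N(P) - N(S₀) there is a stable K ∋ y
--   inside N(P) - N(S₀) with |P ∩ N(K)| ≤ |K|; it compares two maximal stable sets.
-- * Hall inequality (with no isolated vertices): |S| ≤ |N(S)| for stable S, in a
--   relative form proved by induction with the exchange lemma.
-- * For S ∈ Ψ(G) every vertex outside N[S] has a neighbour outside N[S]; with
--   |V| = 2α(G) and the relative Hall inequality this gives |N(S)| ≤ |S|.
-- Conversely, the Hall inequality alone shows that |N(S)| ≤ |S| makes S ∈ Ψ(G).

open import Data.Nat using (ℕ; suc; _+_; _≤_; z≤n; s≤s; _*_)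
open import Data.Nat.Properties
open import Data.Nat.Tactic.RingSolver using (solve-∀)
open import Data.Bool using (Bool; true; false; not; _∧_; _∨_)
open import Data.Bool.Properties using () renaming (_≟_ to _≟ᵇ_)
open import Data.Fin using (Fin)
open import Data.Fin.Properties using (any?)
open import Data.Fin.Subset renaming (⊥ to ∅)
open import Data.Fin.Subset.Properties
open import Data.Fin.Subset.Induction using (⊂-wellFounded)
open import Data.Vec using (_∷_; []; lookup; tabulate; foldr′; here; there)
open import Data.Vec.Properties using (lookup∘tabulate; []=⇒lookup; lookup⇒[]=)
open import Data.List using (List; allFin) renaming ([] to []ˡ; _∷_ to _∷ˡ_)
open import Data.List.Relation.Unary.All as All using (All) renaming ([] to []ᵃ; _∷_ to _∷ᵃ_)
open import Data.List.Membership.Propositional.Properties using (∈-allFin)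
open import Data.Product using (∃; _×_; _,_; proj₁; proj₂)
open import Data.Sum using (_⊎_; inj₁; inj₂; [_,_]′)
open import Data.Empty using (⊥; ⊥-elim)
open import Function.Bundles using (_⇔_; mk⇔; Equivalence)
open import Induction.WellFounded using (Acc; acc)
open import Relation.Nullary using (¬_; Dec; yes; no; ¬?)
open import Relation.Nullary.Decidable using (_×-dec_; _⊎-dec_; toSum; decidable-stable)
open import Relation.Binary.PropositionalEquality
  using (_≡_; refl; trans; subst; cong; module ≡-Reasoning) renaming (sym to ≡-sym)

open import Defs

or-tabulate⁻ : ∀ {m} (f : Fin m → Bool) → foldr′ _∨_ false (tabulate f) ≡ true →
               ∃ λ w → f w ≡ true
or-tabulate⁻ {suc m} f eq with f Fin.zero in f0
... | true  = Fin.zero , f0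
... | false with or-tabulate⁻ (λ w → f (Fin.suc w)) eq
...   | w , fw = Fin.suc w , fw

or-tabulate⁺ : ∀ {m} (f : Fin m → Bool) w → f w ≡ true →
               foldr′ _∨_ false (tabulate f) ≡ true
or-tabulate⁺ f Fin.zero    fw rewrite fw = refl
or-tabulate⁺ f (Fin.suc w) fw with f Fin.zero
... | true  = refl
... | false = or-tabulate⁺ (λ w → f (Fin.suc w)) w fw

x∈p─q⇒x∉q : ∀ {n} (p q : Subset n) {x} → x ∈ p ─ q → x ∉ q
x∈p─q⇒x∉q (s ∷ p) (inside  ∷ q) (there x∈) (there x∈q) = x∈p─q⇒x∉q p q x∈ x∈q
x∈p─q⇒x∉q (s ∷ p) (outside ∷ q) x∈         (there x∈q) = x∈p─q⇒x∉q p q (drop-there x∈) x∈q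

∣p∪q∣≤∣p∣+∣q∣ : ∀ {n} (p q : Subset n) → ∣ p ∪ q ∣ ≤ ∣ p ∣ + ∣ q ∣
∣p∪q∣≤∣p∣+∣q∣ []            []            = z≤n
∣p∪q∣≤∣p∣+∣q∣ (inside  ∷ p) (inside  ∷ q) =
  s≤s (≤-trans (∣p∪q∣≤∣p∣+∣q∣ p q) (+-monoʳ-≤ ∣ p ∣ (n≤1+n _)))
∣p∪q∣≤∣p∣+∣q∣ (inside  ∷ p) (outside ∷ q) = s≤s (∣p∪q∣≤∣p∣+∣q∣ p q)
∣p∪q∣≤∣p∣+∣q∣ (outside ∷ p) (inside  ∷ q) rewrite +-suc ∣ p ∣ ∣ q ∣ = s≤s (∣p∪q∣≤∣p∣+∣q∣ p q)
∣p∪q∣≤∣p∣+∣q∣ (outside ∷ p) (outside ∷ q) = ∣p∪q∣≤∣p∣+∣q∣ p q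

Disjoint : ∀ {n} → Subset n → Subset n → Set
Disjoint p q = ∀ {x} → x ∈ p → x ∈ q → ⊥

∣p∪q∣≡∣p∣+∣q∣ : ∀ {n} (p q : Subset n) → Disjoint p q → ∣ p ∪ q ∣ ≡ ∣ p ∣ + ∣ q ∣
∣p∪q∣≡∣p∣+∣q∣ []            []            _ = refl
∣p∪q∣≡∣p∣+∣q∣ (inside  ∷ p) (inside  ∷ q) d = ⊥-elim (d here here)
∣p∪q∣≡∣p∣+∣q∣ (inside  ∷ p) (outside ∷ q) d =
  cong suc (∣p∪q∣≡∣p∣+∣q∣ p q λ a b → d (there a) (there b))
∣p∪q∣≡∣p∣+∣q∣ (outside ∷ p) (inside  ∷ q) d rewrite +-suc ∣ p ∣ ∣ q ∣ =
  cong suc (∣p∪q∣≡∣p∣+∣q∣ p q λ a b → d (there a) (there b))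
∣p∪q∣≡∣p∣+∣q∣ (outside ∷ p) (outside ∷ q) d = ∣p∪q∣≡∣p∣+∣q∣ p q λ a b → d (there a) (there b)

∣p∣≡∣p∩q∣+∣p─q∣ : ∀ {n} (p q : Subset n) → ∣ p ∣ ≡ ∣ p ∩ q ∣ + ∣ p ─ q ∣
∣p∣≡∣p∩q∣+∣p─q∣ []            []            = refl
∣p∣≡∣p∩q∣+∣p─q∣ (inside  ∷ p) (inside  ∷ q) = cong suc (∣p∣≡∣p∩q∣+∣p─q∣ p q)
∣p∣≡∣p∩q∣+∣p─q∣ (inside  ∷ p) (outside ∷ q) =
  trans (cong suc (∣p∣≡∣p∩q∣+∣p─q∣ p q)) (≡-sym (+-suc ∣ p ∩ q ∣ ∣ p ─ q ∣))
∣p∣≡∣p∩q∣+∣p─q∣ (outside ∷ p) (inside  ∷ q) = ∣p∣≡∣p∩q∣+∣p─q∣ p q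
∣p∣≡∣p∩q∣+∣p─q∣ (outside ∷ p) (outside ∷ q) = ∣p∣≡∣p∩q∣+∣p─q∣ p q

∣p∪⁅x⁆∣≡1+∣p∣ : ∀ {n} (p : Subset n) {x} → x ∉ p → ∣ p ∪ ⁅ x ⁆ ∣ ≡ suc ∣ p ∣
∣p∪⁅x⁆∣≡1+∣p∣ p {x} x∉p = begin
  ∣ p ∪ ⁅ x ⁆ ∣     ≡⟨ ∣p∪q∣≡∣p∣+∣q∣ p ⁅ x ⁆ x∉⁅x⁆ ⟩
  ∣ p ∣ + ∣ ⁅ x ⁆ ∣ ≡⟨ cong (∣ p ∣ +_) (∣⁅x⁆∣≡1 x) ⟩
  ∣ p ∣ + 1         ≡⟨ +-comm ∣ p ∣ 1 ⟩
  suc ∣ p ∣         ∎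
  where
  open ≡-Reasoning
  x∉⁅x⁆ : Disjoint p ⁅ x ⁆
  x∉⁅x⁆ u∈p u∈x = x∉p (subst (_∈ p) (x∈⁅y⁆⇒x≡y x u∈x) u∈p)

module Basics {n : ℕ} (G : Graph n) where

  adj-sym : ∀ {x y} → Adj G x y → Adj G y x
  adj-sym {x} {y} a = trans (sym G y x) a

  ¬adj-self : ∀ x → ¬ Adj G x x
  ¬adj-self x a with trans (≡-sym (irrefl G x)) a
  ... | ()

  ∈N⁻ : ∀ {X x} → x ∈ N G X → x ∉ X × ∃ λ w → w ∈ X × Adj G x w
  ∈N⁻ {X} {x} x∈N with lookup X x in x∈?X
                    | trans (≡-sym (lookup∘tabulate (λ u → not (lookup X u) ∧ hasNbrIn G X u) x))
                            ([]=⇒lookup x∈N)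
  ... | false | nbr with or-tabulate⁻ (λ w → lookup X w ∧ adj G x w) nbr
  ...   | w , w∈X∧adj with lookup X w in w∈X
  ...     | true = (λ x∈X → false≢true (trans (≡-sym x∈?X) ([]=⇒lookup x∈X)))
                   , w , lookup⇒[]= w X w∈X , w∈X∧adj
    where false≢true : false ≡ true → ⊥
          false≢true ()

  ∈N⁺ : ∀ {X x w} → x ∉ X → w ∈ X → Adj G x w → x ∈ N G X
  ∈N⁺ {X} {x} {w} x∉X w∈X a =
    lookup⇒[]= x (N G X) (trans (lookup∘tabulate _ x) (outside-with-nbr (lookup X x) refl))
    where
    outside-with-nbr : ∀ b → lookup X x ≡ b → not b ∧ hasNbrIn G X x ≡ true
    outside-with-nbr true  x∈?X = ⊥-elim (x∉X (lookup⇒[]= x X x∈?X))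
    outside-with-nbr false _    = or-tabulate⁺ (λ w → lookup X w ∧ adj G x w) w
      (subst (λ b → b ∧ adj G x w ≡ true) (≡-sym ([]=⇒lookup w∈X)) a)

  ∉N[]⇒¬adj : ∀ {Y x y} → x ∉ Y → x ∉ N G Y → y ∈ Y → ¬ Adj G x y
  ∉N[]⇒¬adj x∉Y x∉NY y∈Y a = x∉NY (∈N⁺ x∉Y y∈Y a)

  ∉N∅ : ∀ {x} → x ∉ N G ∅
  ∉N∅ x∈N = ∉⊥ (proj₁ (proj₂ (proj₂ (∈N⁻ x∈N))))

  stable-⊆ : ∀ {X Y} → X ⊆ Y → Stable G Y → Stable G X
  stable-⊆ X⊆Y stY x y x∈X y∈X = stY x y (X⊆Y x∈X) (X⊆Y y∈X)

  stable-⁅⁆ : ∀ u → Stable G ⁅ u ⁆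
  stable-⁅⁆ u x y x∈ y∈ with x∈⁅y⁆⇒x≡y u x∈ | x∈⁅y⁆⇒x≡y u y∈
  ... | refl | refl = ¬adj-self u

  stable-∪ : ∀ {X Y} → Stable G X → Stable G Y →
             (∀ x y → x ∈ X → y ∈ Y → ¬ Adj G x y) → Stable G (X ∪ Y)
  stable-∪ {X} {Y} stX stY cross x y x∈ y∈ with x∈p∪q⁻ X Y x∈ | x∈p∪q⁻ X Y y∈
  ... | inj₁ x∈X | inj₁ y∈X = stX x y x∈X y∈X
  ... | inj₁ x∈X | inj₂ y∈Y = cross x y x∈X y∈Y
  ... | inj₂ x∈Y | inj₁ y∈X = λ a → cross y x y∈X x∈Y (adj-sym a)
  ... | inj₂ x∈Y | inj₂ y∈Y = stY x y x∈Y y∈Y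

  DominatedBy : Subset n → Fin n → Set
  DominatedBy J u = u ∈ J ⊎ ∃ λ w → w ∈ J × Adj G u w

  dominated? : ∀ J u → Dec (DominatedBy J u)
  dominated? J u = (u ∈? J) ⊎-dec any? (λ w → (w ∈? J) ×-dec (adj G u w ≟ᵇ true))

  dominated-mono : ∀ {J J′ u} → J ⊆ J′ → DominatedBy J u → DominatedBy J′ u
  dominated-mono J⊆J′ (inj₁ u∈J)            = inj₁ (J⊆J′ u∈J)
  dominated-mono J⊆J′ (inj₂ (w , w∈J , a)) = inj₂ (w , J⊆J′ w∈J , a)

  N[]-dominated : ∀ {J u} → u ∈ N[ G ] J → DominatedBy J u
  N[]-dominated {J} u∈ with x∈p∪q⁻ J (N G J) u∈
  ... | inj₁ u∈J  = inj₁ u∈J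
  ... | inj₂ u∈NJ = inj₂ (proj₂ (∈N⁻ u∈NJ))

  -- A maximal stable set of G[W] extending X: a stable subset of W dominating W.
  record MaximalExtension (W X : Subset n) : Set where
    field
      set       : Subset n
      extends   : X ⊆ set
      within    : set ⊆ W
      stable    : Stable G set
      dominates : ∀ u → u ∈ W → DominatedBy set u

  -- Greedy extension: scan the vertices us, adding each vertex of W not yet dominated.
  -- Dominated vertices stay dominated, so afterwards every vertex of us in W is.
  greedy : ∀ W (us : List (Fin n)) J → J ⊆ W → Stable G J →
           ∃ λ J′ → J ⊆ J′ × J′ ⊆ W × Stable G J′ × All (λ u → u ∈ W → DominatedBy J′ u) us
  greedy W []ˡ        J J⊆W stJ = J , ⊆-refl , J⊆W , stJ , []ᵃ
  greedy W (u ∷ˡ us) J J⊆W stJ with u ∈? W | dominated? J u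
  ... | no u∉W | _ =
    let J′ , J⊆J′ , J′⊆W , stJ′ , dom = greedy W us J J⊆W stJ
    in  J′ , J⊆J′ , J′⊆W , stJ′ , (λ u∈W → ⊥-elim (u∉W u∈W)) ∷ᵃ dom
  ... | yes _ | yes u-dom =
    let J′ , J⊆J′ , J′⊆W , stJ′ , dom = greedy W us J J⊆W stJ
    in  J′ , J⊆J′ , J′⊆W , stJ′ , (λ _ → dominated-mono J⊆J′ u-dom) ∷ᵃ dom
  ... | yes u∈W | no u-free =
    let J′ , J+u⊆J′ , J′⊆W , stJ′ , dom = greedy W us (J ∪ ⁅ u ⁆) J+u⊆W stJ+u
    in  J′ , (λ w∈J → J+u⊆J′ (p⊆p∪q ⁅ u ⁆ w∈J)) , J′⊆W , stJ′
        , (λ _ → inj₁ (J+u⊆J′ (q⊆p∪q J ⁅ u ⁆ (x∈⁅x⁆ u)))) ∷ᵃ dom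
    where
    J+u⊆W : J ∪ ⁅ u ⁆ ⊆ W
    J+u⊆W w∈ with x∈p∪q⁻ J ⁅ u ⁆ w∈
    ... | inj₁ w∈J = J⊆W w∈J
    ... | inj₂ w∈u = subst (_∈ W) (≡-sym (x∈⁅y⁆⇒x≡y u w∈u)) u∈W
    stJ+u : Stable G (J ∪ ⁅ u ⁆)
    stJ+u = stable-∪ stJ (stable-⁅⁆ u) λ x y x∈J y∈u a →
      u-free (inj₂ (x , x∈J , adj-sym (subst (Adj G x) (x∈⁅y⁆⇒x≡y u y∈u) a)))

  -- Every stable subset of W extends to a maximal stable set of G[W].
  -- (Opaque: only the specification of the extension matters, never its computation.)
  opaque
    extend : ∀ {W X} → X ⊆ W → Stable G X → MaximalExtension W X
    extend {W} {X} X⊆W stX =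
      let J , X⊆J , J⊆W , stJ , dom = greedy W (allFin n) X X⊆W stX
      in  record { set = J ; extends = X⊆J ; within = J⊆W ; stable = stJ
                 ; dominates = λ u → All.lookup dom (∈-allFin u) }

  dominating⇒maximal : ∀ {M} → Stable G M → (∀ u → DominatedBy M u) → MaximalStable G M
  dominating⇒maximal stM dom = stM , λ T stT M⊆T {x} x∈T → in-M T stT M⊆T x∈T (dom x)
    where
    in-M : ∀ {M} T → Stable G T → M ⊆ T → ∀ {x} → x ∈ T → DominatedBy M x → x ∈ M
    in-M T stT M⊆T x∈T (inj₁ x∈M)            = x∈M
    in-M T stT M⊆T x∈T (inj₂ (w , w∈M , a)) = ⊥-elim (stT _ w x∈T (M⊆T w∈M) a)

  maximum⇒maximal : ∀ {S} → MaximumStable G S → MaximalStable G S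
  maximum⇒maximal {S} (_ , stS , largest) = stS , λ T stT S⊆T {x} x∈T → in-S T stT S⊆T x∈T
    where
    in-S : ∀ T → Stable G T → S ⊆ T → ∀ {x} → x ∈ T → x ∈ S
    in-S T stT S⊆T {x} x∈T with x ∈? S
    ... | yes x∈S = x∈S
    ... | no  x∉S = ⊥-elim (<⇒≱ (p⊂q⇒∣p∣<∣q∣ (S⊆T , x , x∈T , x∉S)) (largest T (λ _ → ∈⊤) stT))

  Outside : Subset n → Subset n
  Outside P = ∁ (N[ G ] P)

  outside⁻ : ∀ {P u} → u ∈ Outside P → u ∉ P × u ∉ N G P
  outside⁻ {P} u∈ = (λ u∈P → x∈∁p⇒x∉p u∈ (x∈p∪q⁺ (inj₁ u∈P)))
                  , (λ u∈NP → x∈∁p⇒x∉p u∈ (x∈p∪q⁺ (inj₂ u∈NP)))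

  outside⁺ : ∀ {P u} → u ∉ P → u ∉ N G P → u ∈ Outside P
  outside⁺ {P} u∉P u∉NP = x∉p⇒x∈∁p λ u∈ → [ u∉P , u∉NP ]′ (x∈p∪q⁻ P (N G P) u∈)

  completion-maximal : ∀ {P J} → Stable G P → J ⊆ Outside P → Stable G J →
                       (∀ u → u ∈ Outside P → DominatedBy J u) → MaximalStable G (P ∪ J)
  completion-maximal {P} {J} stP J⊆out stJ domJ = dominating⇒maximal st dom
    where
    st : Stable G (P ∪ J)
    st = stable-∪ stP stJ λ p j p∈P j∈J a →
      let j∉P , j∉NP = outside⁻ (J⊆out j∈J) in ∉N[]⇒¬adj j∉P j∉NP p∈P (adj-sym a)
    dom : ∀ u → DominatedBy (P ∪ J) u
    dom u with u ∈? N[ G ] P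
    ... | yes u∈N[P] = dominated-mono (p⊆p∪q J) (N[]-dominated u∈N[P])
    ... | no  u∉N[P] = dominated-mono (q⊆p∪q P J) (domJ u (x∉p⇒x∈∁p u∉N[P]))

  completion-size : ∀ {P J} → J ⊆ Outside P → ∣ P ∪ J ∣ ≡ ∣ P ∣ + ∣ J ∣
  completion-size {P} {J} J⊆out = ∣p∪q∣≡∣p∣+∣q∣ P J λ p∈P p∈J → proj₁ (outside⁻ (J⊆out p∈J)) p∈P

-- Let P be stable, S₀ ⊆ P and y ∈ N(P) - N(S₀).  Choose
--   J′ a maximal stable set of G[Outside P - N(y)],
--   K  a maximal stable set of G[(N(P) - N(S₀)) - N(J′)] containing y,
--   J″ a maximal stable set of G[Outside P] extending J′.
-- Then P ∪ J″ and J′ ∪ K ∪ (P - N(K)) are both maximal stable sets of G; comparing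
-- their sizes in a well-covered graph gives |P ∩ N(K)| ≤ |K|.
module Exchange {n : ℕ} (G : Graph n) (wc : WellCovered G)
                {P S₀ : Subset n} (stP : Stable G P) (S₀⊆P : S₀ ⊆ P)
                {y : Fin n} (y∈NP : y ∈ N G P) (y∉NS₀ : y ∉ N G S₀) where
  open Basics G
  open MaximalExtension

  J′-ext : MaximalExtension (Outside P ─ N G ⁅ y ⁆) ∅
  J′-ext = extend (λ u∈∅ → ⊥-elim (∉⊥ u∈∅)) (λ _ _ u∈∅ → ⊥-elim (∉⊥ u∈∅))

  J′ : Subset n
  J′ = set J′-ext

  J′-outside : ∀ {j} → j ∈ J′ → j ∉ P × j ∉ N G P
  J′-outside j∈J′ = outside⁻ (p─q⊆p (Outside P) (N G ⁅ y ⁆) (within J′-ext j∈J′))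

  -- The region where K is chosen; it contains y because J′ avoids N(y).
  Near : Subset n
  Near = (N G P ─ N G S₀) ─ N G J′

  y∈Near : y ∈ Near
  y∈Near = x∈p∧x∉q⇒x∈p─q (x∈p∧x∉q⇒x∈p─q y∈NP y∉NS₀) y∉NJ′
    where
    y∉NJ′ : y ∉ N G J′
    y∉NJ′ y∈NJ′ =
      let _ , j , j∈J′ , a = ∈N⁻ y∈NJ′
          j∉P , j∉NP = J′-outside j∈J′
          j∉y : j ∉ ⁅ y ⁆
          j∉y j∈y = j∉NP (subst (_∈ N G P) (≡-sym (x∈⁅y⁆⇒x≡y y j∈y)) y∈NP)
      in x∈p─q⇒x∉q (Outside P) (N G ⁅ y ⁆) (within J′-ext j∈J′) (∈N⁺ j∉y (x∈⁅x⁆ y) (adj-sym a))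

  K-ext : MaximalExtension Near ⁅ y ⁆
  K-ext = extend (λ u∈y → subst (_∈ Near) (≡-sym (x∈⁅y⁆⇒x≡y y u∈y)) y∈Near) (stable-⁅⁆ y)

  K : Subset n
  K = set K-ext

  y∈K : y ∈ K
  y∈K = extends K-ext (x∈⁅x⁆ y)

  K-stable : Stable G K
  K-stable = stable K-ext

  K⊆NP─NS₀ : K ⊆ N G P ─ N G S₀
  K⊆NP─NS₀ k∈K = p─q⊆p (N G P ─ N G S₀) (N G J′) (within K-ext k∈K)

  K∉NJ′ : ∀ {k} → k ∈ K → k ∉ N G J′
  K∉NJ′ k∈K = x∈p─q⇒x∉q (N G P ─ N G S₀) (N G J′) (within K-ext k∈K)

  K∉NS₀ : ∀ {k} → k ∈ K → k ∉ N G S₀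
  K∉NS₀ k∈K = x∈p─q⇒x∉q (N G P) (N G S₀) (K⊆NP─NS₀ k∈K)

  K⊆NP : K ⊆ N G P
  K⊆NP k∈K = p─q⊆p (N G P) (N G S₀) (K⊆NP─NS₀ k∈K)

  K∉P : ∀ {k} → k ∈ K → k ∉ P
  K∉P k∈K = proj₁ (∈N⁻ (K⊆NP k∈K))

  J″-ext : MaximalExtension (Outside P) J′
  J″-ext = extend (λ j∈J′ → p─q⊆p (Outside P) (N G ⁅ y ⁆) (within J′-ext j∈J′)) (stable J′-ext)

  J″ : Subset n
  J″ = set J″-ext

  M₁-maximal : MaximalStable G (P ∪ J″)
  M₁-maximal = completion-maximal stP (within J″-ext) (stable J″-ext) (dominates J″-ext)

  M₂ : Subset n
  M₂ = (J′ ∪ K) ∪ (P ─ N G K)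

  -- M₂ is stable: J′ avoids N[P] ⊇ K, K avoids N(J′), and P - N(K) avoids N(K).
  in-J′ : J′ ⊆ M₂
  in-J′ j∈J′ = x∈p∪q⁺ (inj₁ (x∈p∪q⁺ (inj₁ j∈J′)))

  in-K : K ⊆ M₂
  in-K k∈K = x∈p∪q⁺ (inj₁ (x∈p∪q⁺ (inj₂ k∈K)))

  in-P─NK : P ─ N G K ⊆ M₂
  in-P─NK p∈ = x∈p∪q⁺ (inj₂ p∈)

  M₂-stable : Stable G M₂
  M₂-stable =
    stable-∪ (stable-∪ (stable J′-ext) K-stable J′-K) (stable-⊆ (p─q⊆p P (N G K)) stP) J′K-P
    where
    J′-K : ∀ j k → j ∈ J′ → k ∈ K → ¬ Adj G j k
    J′-K j k j∈J′ k∈K a =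
      ∉N[]⇒¬adj (λ k∈J′ → proj₂ (J′-outside k∈J′) (K⊆NP k∈K)) (K∉NJ′ k∈K) j∈J′ (adj-sym a)
    J′K-P : ∀ v p → v ∈ J′ ∪ K → p ∈ P ─ N G K → ¬ Adj G v p
    J′K-P v p v∈ p∈ = [ J′-P , K-P ]′ (x∈p∪q⁻ J′ K v∈)
      where
      J′-P : v ∈ J′ → ¬ Adj G v p
      J′-P v∈J′ = let v∉P , v∉NP = J′-outside v∈J′ in ∉N[]⇒¬adj v∉P v∉NP (p─q⊆p P (N G K) p∈)
      K-P : v ∈ K → ¬ Adj G v p
      K-P v∈K a = ∉N[]⇒¬adj (λ p∈K → K∉P p∈K (p─q⊆p P (N G K) p∈)) (x∈p─q⇒x∉q P (N G K) p∈)
                            v∈K (adj-sym a)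

  dominates-P : ∀ {u} → u ∈ P → DominatedBy M₂ u
  dominates-P {u} u∈P = [ via-K , in-P─NK′ ]′ (toSum (u ∈? N G K))
    where
    via-K : u ∈ N G K → DominatedBy M₂ u
    via-K u∈NK = let _ , k , k∈K , a = ∈N⁻ u∈NK in inj₂ (k , in-K k∈K , a)
    in-P─NK′ : u ∉ N G K → DominatedBy M₂ u
    in-P─NK′ u∉NK = inj₁ (in-P─NK (x∈p∧x∉q⇒x∈p─q u∈P u∉NK))

  -- A neighbour of u in S₀ lies in P - N(K), since K avoids N(S₀).
  dominates-NS₀ : ∀ {u} → u ∈ N G S₀ → DominatedBy M₂ u
  dominates-NS₀ u∈NS₀ =
    let _ , s , s∈S₀ , a = ∈N⁻ u∈NS₀
    in inj₂ (s , in-P─NK (x∈p∧x∉q⇒x∈p─q (S₀⊆P s∈S₀) (s∉NK s∈S₀)) , a)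
    where
    s∉NK : ∀ {s} → s ∈ S₀ → s ∉ N G K
    s∉NK s∈S₀ s∈NK =
      let _ , k , k∈K , b = ∈N⁻ s∈NK
      in ∉N[]⇒¬adj (λ k∈S₀ → K∉P k∈K (S₀⊆P k∈S₀)) (K∉NS₀ k∈K) s∈S₀ (adj-sym b)

  -- A vertex of N(P) is dominated through S₀, through J′, or else lies in Near.
  dominates-NP : ∀ {u} → u ∈ N G P → DominatedBy M₂ u
  dominates-NP {u} u∈NP = [ dominates-NS₀ , not-NS₀ ]′ (toSum (u ∈? N G S₀))
    where
    via-J′ : u ∈ N G J′ → DominatedBy M₂ u
    via-J′ u∈NJ′ = let _ , j , j∈J′ , a = ∈N⁻ u∈NJ′ in inj₂ (j , in-J′ j∈J′ , a)
    via-K : u ∉ N G S₀ → u ∉ N G J′ → DominatedBy M₂ u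
    via-K u∉NS₀ u∉NJ′ =
      dominated-mono in-K (dominates K-ext u (x∈p∧x∉q⇒x∈p─q (x∈p∧x∉q⇒x∈p─q u∈NP u∉NS₀) u∉NJ′))
    not-NS₀ : u ∉ N G S₀ → DominatedBy M₂ u
    not-NS₀ u∉NS₀ = [ via-J′ , via-K u∉NS₀ ]′ (toSum (u ∈? N G J′))

  -- A vertex outside N[P] is adjacent to y ∈ K or lies in the region of J′.
  dominates-outside : ∀ {u} → u ∈ Outside P → DominatedBy M₂ u
  dominates-outside {u} u∈out = [ via-y , via-J′ ]′ (toSum (u ∈? N G ⁅ y ⁆))
    where
    via-y : u ∈ N G ⁅ y ⁆ → DominatedBy M₂ u
    via-y u∈Ny = let _ , w , w∈y , a = ∈N⁻ u∈Ny
                 in inj₂ (y , in-K y∈K , subst (Adj G u) (x∈⁅y⁆⇒x≡y y w∈y) a)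
    via-J′ : u ∉ N G ⁅ y ⁆ → DominatedBy M₂ u
    via-J′ u∉Ny = dominated-mono in-J′ (dominates J′-ext u (x∈p∧x∉q⇒x∈p─q u∈out u∉Ny))

  M₂-maximal : MaximalStable G M₂
  M₂-maximal = dominating⇒maximal M₂-stable λ u →
    [ dominates-P , (λ u∉P → [ dominates-NP , (λ u∉NP → dominates-outside (outside⁺ u∉P u∉NP)) ]′
                                 (toSum (u ∈? N G P))) ]′
      (toSum (u ∈? P))

  exchange-bound : ∣ P ∩ N G K ∣ ≤ ∣ K ∣
  exchange-bound = +-cancelʳ-≤ ∣ P ─ N G K ∣ _ _ (+-cancelʳ-≤ ∣ J″ ∣ _ _ (begin
    (∣ P ∩ N G K ∣ + ∣ P ─ N G K ∣) + ∣ J″ ∣ ≡⟨ cong (_+ ∣ J″ ∣) (∣p∣≡∣p∩q∣+∣p─q∣ P (N G K)) ⟨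
    ∣ P ∣ + ∣ J″ ∣                           ≡⟨ completion-size (within J″-ext) ⟨
    ∣ P ∪ J″ ∣                               ≡⟨ wc _ _ M₁-maximal M₂-maximal ⟩
    ∣ M₂ ∣                                   ≤⟨ ∣p∪q∣≤∣p∣+∣q∣ (J′ ∪ K) _ ⟩
    ∣ J′ ∪ K ∣ + ∣ P ─ N G K ∣                ≤⟨ +-monoˡ-≤ _ (∣p∪q∣≤∣p∣+∣q∣ J′ K) ⟩
    (∣ J′ ∣ + ∣ K ∣) + ∣ P ─ N G K ∣           ≤⟨ +-monoˡ-≤ _ (+-monoˡ-≤ ∣ K ∣ J′≤J″) ⟩
    (∣ J″ ∣ + ∣ K ∣) + ∣ P ─ N G K ∣           ≡⟨ +-assoc ∣ J″ ∣ ∣ K ∣ _ ⟩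
    ∣ J″ ∣ + (∣ K ∣ + ∣ P ─ N G K ∣)           ≡⟨ +-comm ∣ J″ ∣ _ ⟩
    (∣ K ∣ + ∣ P ─ N G K ∣) + ∣ J″ ∣           ∎))
    where
    open ≤-Reasoning
    J′≤J″ : ∣ J′ ∣ ≤ ∣ J″ ∣
    J′≤J″ = p⊆q⇒∣p∣≤∣q∣ (extends J″-ext)

record ExchangeSet {n : ℕ} (G : Graph n) (P S₀ : Subset n) (y : Fin n) : Set where
  field
    K        : Subset n
    y∈K      : y ∈ K
    K⊆NP─NS₀ : K ⊆ N G P ─ N G S₀
    K-stable : Stable G K
    K-bound  : ∣ P ∩ N G K ∣ ≤ ∣ K ∣

exchange : ∀ {n} (G : Graph n) → WellCovered G → ∀ {P S₀ y} →
           Stable G P → S₀ ⊆ P → y ∈ N G P → y ∉ N G S₀ → ExchangeSet G P S₀ y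
exchange G wc stP S₀⊆P y∈NP y∉NS₀ = record
  { K = K ; y∈K = y∈K ; K⊆NP─NS₀ = K⊆NP─NS₀ ; K-stable = K-stable ; K-bound = exchange-bound }
  where open Exchange G wc stP S₀⊆P y∈NP y∉NS₀

-- If S₀ ∪ S is stable and every vertex of S has a
-- neighbour outside N(S₀), then |S| ≤ |N(S) - N(S₀)|.  Induction on S along ⊂: for
-- x ∈ S with such a neighbour y, the exchange lemma (with P = S₀ ∪ S) yields K ∋ y;
-- S ∩ N(K) is paid for by K and S - N(K), a proper subset of S, by induction.
module RelativeHall {n : ℕ} (G : Graph n) (wc : WellCovered G) (S₀ : Subset n) where
  open Basics G

  Escapes : Subset n → Set
  Escapes S = ∀ {x} → x ∈ S → ∃ λ y → Adj G x y × y ∉ N G S₀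

  module Step {S : Subset n} (stP : Stable G (S₀ ∪ S)) (esc : Escapes S)
              {x : Fin n} (x∈S : x ∈ S) where
    P : Subset n
    P = S₀ ∪ S

    S⊆P : S ⊆ P
    S⊆P = q⊆p∪q S₀ S

    y : Fin n
    y = proj₁ (esc x∈S)

    x~y : Adj G x y
    x~y = proj₁ (proj₂ (esc x∈S))

    y∈NP : y ∈ N G P
    y∈NP = ∈N⁺ (λ y∈P → stP x y (S⊆P x∈S) y∈P x~y) (S⊆P x∈S) (adj-sym x~y)

    open ExchangeSet (exchange G wc stP (p⊆p∪q S) y∈NP (proj₂ (proj₂ (esc x∈S))))

    K⊆NP : K ⊆ N G P
    K⊆NP k∈K = p─q⊆p (N G P) (N G S₀) (K⊆NP─NS₀ k∈K)

    K∉NS₀ : ∀ {k} → k ∈ K → k ∉ N G S₀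
    K∉NS₀ k∈K = x∈p─q⇒x∉q (N G P) (N G S₀) (K⊆NP─NS₀ k∈K)

    K∉P : ∀ {k} → k ∈ K → k ∉ P
    K∉P k∈K = proj₁ (∈N⁻ (K⊆NP k∈K))

    -- The part of S not adjacent to K; it misses x, which is adjacent to y ∈ K.
    S′ : Subset n
    S′ = S ─ N G K

    S′⊂S : S′ ⊂ S
    S′⊂S = p∩q≢∅⇒p─q⊂p S (N G K)
      (x , x∈p∩q⁺ (x∈S , ∈N⁺ (λ x∈K → K∉P x∈K (S⊆P x∈S)) y∈K x~y))

    Q : Subset n
    Q = N G S′ ─ N G S₀

    K-Q-disjoint : Disjoint K Q
    K-Q-disjoint k∈K k∈Q =
      let _ , s , s∈S′ , a = ∈N⁻ (p─q⊆p (N G S′) (N G S₀) k∈Q)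
      in x∈p─q⇒x∉q S (N G K) s∈S′
           (∈N⁺ (λ s∈K → K∉P s∈K (S⊆P (p─q⊆p S (N G K) s∈S′))) k∈K (adj-sym a))

    K∪Q⊆NS─NS₀ : K ∪ Q ⊆ N G S ─ N G S₀
    K∪Q⊆NS─NS₀ {u} u∈ = [ from-K , from-Q ]′ (x∈p∪q⁻ K Q u∈)
      where
      from-K : u ∈ K → u ∈ N G S ─ N G S₀
      from-K u∈K =
        let u∉P , w , w∈P , a = ∈N⁻ (K⊆NP u∈K)
            in-NS : w ∈ S₀ ⊎ w ∈ S → u ∈ N G S
            in-NS = [ (λ w∈S₀ → ⊥-elim (K∉NS₀ u∈K (∈N⁺ (λ u∈S₀ → u∉P (p⊆p∪q S u∈S₀)) w∈S₀ a)))
                    , (λ w∈S → ∈N⁺ (λ u∈S → u∉P (S⊆P u∈S)) w∈S a) ]′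
        in x∈p∧x∉q⇒x∈p─q (in-NS (x∈p∪q⁻ S₀ S w∈P)) (K∉NS₀ u∈K)
      from-Q : u ∈ Q → u ∈ N G S ─ N G S₀
      from-Q u∈Q =
        let _ , s , s∈S′ , a = ∈N⁻ (p─q⊆p (N G S′) (N G S₀) u∈Q)
            s∈S = p─q⊆p S (N G K) s∈S′
        in x∈p∧x∉q⇒x∈p─q (∈N⁺ (λ u∈S → stP u s (S⊆P u∈S) (S⊆P s∈S) a) s∈S a)
                          (x∈p─q⇒x∉q (N G S′) (N G S₀) u∈Q)

    step : ∣ S′ ∣ ≤ ∣ Q ∣ → ∣ S ∣ ≤ ∣ N G S ─ N G S₀ ∣
    step ih = begin
      ∣ S ∣                        ≡⟨ ∣p∣≡∣p∩q∣+∣p─q∣ S (N G K) ⟩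
      ∣ S ∩ N G K ∣ + ∣ S′ ∣        ≤⟨ +-mono-≤ (p⊆q⇒∣p∣≤∣q∣ S∩NK⊆P∩NK) ih ⟩
      ∣ P ∩ N G K ∣ + ∣ Q ∣         ≤⟨ +-monoˡ-≤ ∣ Q ∣ K-bound ⟩
      ∣ K ∣ + ∣ Q ∣                 ≡⟨ ∣p∪q∣≡∣p∣+∣q∣ K Q K-Q-disjoint ⟨
      ∣ K ∪ Q ∣                     ≤⟨ p⊆q⇒∣p∣≤∣q∣ K∪Q⊆NS─NS₀ ⟩
      ∣ N G S ─ N G S₀ ∣            ∎
      where
      open ≤-Reasoning
      S∩NK⊆P∩NK : S ∩ N G K ⊆ P ∩ N G K
      S∩NK⊆P∩NK u∈ = let u∈S , u∈NK = x∈p∩q⁻ S (N G K) u∈ in x∈p∩q⁺ (S⊆P u∈S , u∈NK)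

  hall-relative : ∀ S → Stable G (S₀ ∪ S) → Escapes S → ∣ S ∣ ≤ ∣ N G S ─ N G S₀ ∣
  hall-relative S = by-induction S (⊂-wellFounded S)
    where
    by-induction : ∀ S → Acc _⊂_ S → Stable G (S₀ ∪ S) → Escapes S → ∣ S ∣ ≤ ∣ N G S ─ N G S₀ ∣
    by-induction S (acc smaller) stP esc = [ nonempty , empty ]′ (toSum (nonempty? S))
      where
      nonempty : Nonempty S → ∣ S ∣ ≤ ∣ N G S ─ N G S₀ ∣
      nonempty (x , x∈S) = step (by-induction S′ (smaller S′⊂S) stP′ (λ u∈S′ → esc (S′⊆S u∈S′)))
        where
        open Step stP esc x∈S
        S′⊆S : S′ ⊆ S
        S′⊆S = p⊂q⇒p⊆q S′⊂S
        stP′ : Stable G (S₀ ∪ S′)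
        stP′ = stable-⊆ (λ u∈ → [ p⊆p∪q S , (λ u∈S′ → S⊆P (S′⊆S u∈S′)) ]′ (x∈p∪q⁻ S₀ S′ u∈)) stP
      empty : Empty S → ∣ S ∣ ≤ ∣ N G S ─ N G S₀ ∣
      empty S-empty = ≤-trans (p⊆q⇒∣p∣≤∣q∣ {q = ∅} (λ x∈S → ⊥-elim (S-empty (_ , x∈S))))
                               (≤-trans (≤-reflexive (∣⊥∣≡0 n)) z≤n)

hall : ∀ {n} (G : Graph n) → WellCovered G → NoIsolated G → ∀ S → Stable G S → ∣ S ∣ ≤ ∣ N G S ∣
hall G wc no-isolated S stS =
  ≤-trans (hall-relative S (stable-⊆ (⊆-reflexive (∪-identityˡ S)) stS)
                           (λ {x} _ → proj₁ (no-isolated x) , proj₂ (no-isolated x) , ∉N∅))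
          (∣p─q∣≤∣p∣ (N G S) (N G ∅))
  where
  open Basics G
  open RelativeHall G wc ∅

module LocalMaxima {n : ℕ} (G : Graph n) where
  open Basics G

  -- If stable sets satisfy Hall's inequality, a stable S with |N(S)| ≤ |S| is a local
  -- maximum: a stable T ⊆ N[S] splits into T₁ = T ∩ N(S) and T - N(S) ⊆ S - N(T₁), and
  -- T₁ together with N(S - N(T₁)) is a disjoint union inside N(S).
  small-boundary⇒localMax : (∀ X → Stable G X → ∣ X ∣ ≤ ∣ N G X ∣) →
                            ∀ {S} → Stable G S → ∣ N G S ∣ ≤ ∣ S ∣ → LocalMax G S
  small-boundary⇒localMax hall-ineq {S} stS NS≤S = p⊆p∪q (N G S) , stS , bounded
    where
    bounded : ∀ T → T ⊆ N[ G ] S → Stable G T → ∣ T ∣ ≤ ∣ S ∣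
    bounded T T⊆N[S] stT = begin
      ∣ T ∣                 ≡⟨ ∣p∣≡∣p∩q∣+∣p─q∣ T (N G S) ⟩
      ∣ T₁ ∣ + ∣ T ─ N G S ∣ ≤⟨ +-monoʳ-≤ ∣ T₁ ∣ (p⊆q⇒∣p∣≤∣q∣ T─NS⊆S′) ⟩
      ∣ T₁ ∣ + ∣ S′ ∣        ≤⟨ +-monoʳ-≤ ∣ T₁ ∣ (hall-ineq S′ (stable-⊆ S′⊆S stS)) ⟩
      ∣ T₁ ∣ + ∣ N G S′ ∣    ≡⟨ ∣p∪q∣≡∣p∣+∣q∣ T₁ (N G S′) T₁-NS′-disjoint ⟨
      ∣ T₁ ∪ N G S′ ∣        ≤⟨ p⊆q⇒∣p∣≤∣q∣ T₁∪NS′⊆NS ⟩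
      ∣ N G S ∣             ≤⟨ NS≤S ⟩
      ∣ S ∣                 ∎
      where
      open ≤-Reasoning
      T₁ : Subset n
      T₁ = T ∩ N G S
      S′ : Subset n
      S′ = S ─ N G T₁
      S′⊆S : S′ ⊆ S
      S′⊆S = p─q⊆p S (N G T₁)
      T₁⊆NS : T₁ ⊆ N G S
      T₁⊆NS = p∩q⊆q T (N G S)
      T─NS⊆S′ : T ─ N G S ⊆ S′
      T─NS⊆S′ {t} t∈ =
        let t∈T = p─q⊆p T (N G S) t∈
            t∉NS = x∈p─q⇒x∉q T (N G S) t∈
            t∈S = [ (λ t∈S → t∈S) , (λ t∈NS → ⊥-elim (t∉NS t∈NS)) ]′ (x∈p∪q⁻ S (N G S) (T⊆N[S] t∈T))
        in x∈p∧x∉q⇒x∈p─q t∈S λ t∈NT₁ →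
             let _ , w , w∈T₁ , a = ∈N⁻ t∈NT₁ in stT t w t∈T (p∩q⊆p T (N G S) w∈T₁) a
      T₁-NS′-disjoint : Disjoint T₁ (N G S′)
      T₁-NS′-disjoint u∈T₁ u∈NS′ =
        let _ , s , s∈S′ , a = ∈N⁻ u∈NS′
            s∉T₁ = λ s∈T₁ → proj₁ (∈N⁻ (T₁⊆NS s∈T₁)) (S′⊆S s∈S′)
        in x∈p─q⇒x∉q S (N G T₁) s∈S′ (∈N⁺ s∉T₁ u∈T₁ (adj-sym a))
      T₁∪NS′⊆NS : T₁ ∪ N G S′ ⊆ N G S
      T₁∪NS′⊆NS {u} u∈ = [ T₁⊆NS , from-NS′ ]′ (x∈p∪q⁻ T₁ (N G S′) u∈)
        where
        from-NS′ : u ∈ N G S′ → u ∈ N G S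
        from-NS′ u∈NS′ = let _ , s , s∈S′ , a = ∈N⁻ u∈NS′
                         in ∈N⁺ (λ u∈S → stS u s u∈S (S′⊆S s∈S′) a) (S′⊆S s∈S′) a

  -- Let S ∈ Ψ(G) and z ∉ N[S].  If every neighbour of z lay in N(S), apply the exchange
  -- lemma to P = S ∪ {z} and a neighbour y of z: then T = K ∪ (S - N(K)) ⊆ N[S] is
  -- stable, while |T| ≥ |P ∩ N(K)| + |S - N(K)| ≥ |S| + 1 because z ∈ N(K).
  module Trapped (wc : WellCovered G) (no-isolated : NoIsolated G)
                 {S : Subset n} (lmS : LocalMax G S) {z : Fin n} (z∉S : z ∉ S) (z∉NS : z ∉ N G S)
                 (trapped : ∀ y → Adj G z y → y ∈ N G S) where
    stS : Stable G S
    stS = proj₁ (proj₂ lmS)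

    P : Subset n
    P = S ∪ ⁅ z ⁆

    S⊆P : S ⊆ P
    S⊆P = p⊆p∪q ⁅ z ⁆

    z∈P : z ∈ P
    z∈P = q⊆p∪q S ⁅ z ⁆ (x∈⁅x⁆ z)

    stP : Stable G P
    stP = stable-∪ stS (stable-⁅⁆ z) λ s u s∈S u∈z a →
      ∉N[]⇒¬adj z∉S z∉NS s∈S (adj-sym (subst (Adj G s) (x∈⁅y⁆⇒x≡y z u∈z) a))

    y : Fin n
    y = proj₁ (no-isolated z)

    z~y : Adj G z y
    z~y = proj₂ (no-isolated z)

    y∈NP : y ∈ N G P
    y∈NP = ∈N⁺ (λ y∈P → stP z y z∈P y∈P z~y) z∈P (adj-sym z~y)

    open ExchangeSet (exchange G wc stP (λ u∈∅ → ⊥-elim (∉⊥ u∈∅)) y∈NP ∉N∅)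

    K⊆NP : K ⊆ N G P
    K⊆NP k∈K = p─q⊆p (N G P) (N G ∅) (K⊆NP─NS₀ k∈K)

    K∉P : ∀ {k} → k ∈ K → k ∉ P
    K∉P k∈K = proj₁ (∈N⁻ (K⊆NP k∈K))

    T : Subset n
    T = K ∪ (S ─ N G K)

    K⊆N[S] : K ⊆ N[ G ] S
    K⊆N[S] {k} k∈K =
      let k∉P , w , w∈P , a = ∈N⁻ (K⊆NP k∈K)
          via-S : w ∈ S → k ∈ N G S
          via-S w∈S = ∈N⁺ (λ k∈S → k∉P (S⊆P k∈S)) w∈S a
          via-z : w ∈ ⁅ z ⁆ → k ∈ N G S
          via-z w∈z = trapped k (adj-sym (subst (Adj G k) (x∈⁅y⁆⇒x≡y z w∈z) a))
      in q⊆p∪q S (N G S) ([ via-S , via-z ]′ (x∈p∪q⁻ S ⁅ z ⁆ w∈P))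

    T⊆N[S] : T ⊆ N[ G ] S
    T⊆N[S] u∈ = [ K⊆N[S] , (λ u∈S─NK → p⊆p∪q (N G S) (p─q⊆p S (N G K) u∈S─NK)) ]′ (x∈p∪q⁻ K _ u∈)

    stT : Stable G T
    stT = stable-∪ K-stable (stable-⊆ (p─q⊆p S (N G K)) stS) λ k s k∈K s∈ a →
      ∉N[]⇒¬adj (λ s∈K → K∉P s∈K (S⊆P (p─q⊆p S (N G K) s∈))) (x∈p─q⇒x∉q S (N G K) s∈)
                k∈K (adj-sym a)

    -- (S ∩ N(K)) ∪ {z} ⊆ P ∩ N(K), since z is adjacent to y ∈ K.
    S∩NK<P∩NK : suc ∣ S ∩ N G K ∣ ≤ ∣ P ∩ N G K ∣
    S∩NK<P∩NK = begin
      suc ∣ S ∩ N G K ∣        ≡⟨ ∣p∪⁅x⁆∣≡1+∣p∣ (S ∩ N G K) (λ z∈ → z∉S (p∩q⊆p S (N G K) z∈)) ⟨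
      ∣ S ∩ N G K ∪ ⁅ z ⁆ ∣     ≤⟨ p⊆q⇒∣p∣≤∣q∣ S∩NK+z⊆P∩NK ⟩
      ∣ P ∩ N G K ∣            ∎
      where
      open ≤-Reasoning
      z∈NK : z ∈ N G K
      z∈NK = ∈N⁺ (λ z∈K → K∉P z∈K z∈P) y∈K z~y
      S∩NK+z⊆P∩NK : S ∩ N G K ∪ ⁅ z ⁆ ⊆ P ∩ N G K
      S∩NK+z⊆P∩NK {u} u∈ = [ from-S , from-z ]′ (x∈p∪q⁻ (S ∩ N G K) ⁅ z ⁆ u∈)
        where
        from-S : u ∈ S ∩ N G K → u ∈ P ∩ N G K
        from-S u∈ = let u∈S , u∈NK = x∈p∩q⁻ S (N G K) u∈ in x∈p∩q⁺ (S⊆P u∈S , u∈NK)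
        from-z : u ∈ ⁅ z ⁆ → u ∈ P ∩ N G K
        from-z u∈z = subst (_∈ P ∩ N G K) (≡-sym (x∈⁅y⁆⇒x≡y z u∈z)) (x∈p∩q⁺ (z∈P , z∈NK))

    absurd : ⊥
    absurd = <-irrefl refl (begin-strict
      ∣ S ∣                              ≡⟨ ∣p∣≡∣p∩q∣+∣p─q∣ S (N G K) ⟩
      ∣ S ∩ N G K ∣ + ∣ S ─ N G K ∣       <⟨ +-monoˡ-≤ ∣ S ─ N G K ∣ S∩NK<P∩NK ⟩
      ∣ P ∩ N G K ∣ + ∣ S ─ N G K ∣       ≤⟨ +-monoˡ-≤ ∣ S ─ N G K ∣ K-bound ⟩
      ∣ K ∣ + ∣ S ─ N G K ∣               ≡⟨ ∣p∪q∣≡∣p∣+∣q∣ K (S ─ N G K) K-S─NK-disjoint ⟨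
      ∣ T ∣                              ≤⟨ proj₂ (proj₂ lmS) T T⊆N[S] stT ⟩
      ∣ S ∣                              ∎)
      where
      open ≤-Reasoning
      K-S─NK-disjoint : Disjoint K (S ─ N G K)
      K-S─NK-disjoint k∈K k∈ = K∉P k∈K (S⊆P (p─q⊆p S (N G K) k∈))

  escape : WellCovered G → NoIsolated G → ∀ {S} → LocalMax G S →
           ∀ {z} → z ∉ S → z ∉ N G S → ∃ λ y → Adj G z y × y ∉ N G S
  escape wc no-isolated {S} lmS {z} z∉S z∉NS =
    [ (λ found → found)
    , (λ none → ⊥-elim (Trapped.absurd wc no-isolated lmS z∉S z∉NS (trapped none))) ]′
      (toSum (any? λ y → (adj G z y ≟ᵇ true) ×-dec ¬? (y ∈? N G S)))
    where
    trapped : ¬ (∃ λ y → Adj G z y × y ∉ N G S) → ∀ y → Adj G z y → y ∈ N G S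
    trapped none y a = decidable-stable (y ∈? N G S) λ y∉NS → none (y , a , y∉NS)

  -- Complete S by a maximal
  -- stable set J of G[Outside S] to a maximal stable set S ∪ J of size α(G) = n/2.
  -- Every vertex of J escapes N(S), so |J| ≤ |Q| for Q = N(J) - N(S) by the relative
  -- Hall inequality, and S, N(S), J, Q are disjoint: |S| + |N(S)| + 2|J| ≤ n = 2|S| + 2|J|.
  module Boundary (vwc : VeryWellCovered G) {S : Subset n} (lmS : LocalMax G S) where
    open MaximalExtension

    wc : WellCovered G
    wc = proj₁ vwc

    J-ext : MaximalExtension (Outside S) ∅
    J-ext = extend (λ u∈∅ → ⊥-elim (∉⊥ u∈∅)) (λ _ _ u∈∅ → ⊥-elim (∉⊥ u∈∅))

    J : Subset n
    J = set J-ext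

    J-outside : ∀ {j} → j ∈ J → j ∉ S × j ∉ N G S
    J-outside j∈J = outside⁻ (within J-ext j∈J)

    S∪J-maximal : MaximalStable G (S ∪ J)
    S∪J-maximal =
      completion-maximal (proj₁ (proj₂ lmS)) (within J-ext) (stable J-ext) (dominates J-ext)

    half-order : n ≡ 2 * (∣ S ∣ + ∣ J ∣)
    half-order =
      let S* , S*-maximum , n≡2α = proj₂ (proj₂ vwc)
      in trans n≡2α (cong (2 *_) (trans (wc S* (S ∪ J) (maximum⇒maximal S*-maximum) S∪J-maximal)
                                        (completion-size (within J-ext))))

    Q : Subset n
    Q = N G J ─ N G S

    J≤Q : ∣ J ∣ ≤ ∣ Q ∣
    J≤Q = hall-relative J (proj₁ S∪J-maximal) λ j∈J →
            let j∉S , j∉NS = J-outside j∈J in escape wc (proj₁ (proj₂ vwc)) lmS j∉S j∉NS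
      where open RelativeHall G wc S

    Q-disjoint : Disjoint (N[ G ] S ∪ J) Q
    Q-disjoint {u} u∈ u∈Q =
      let u∈NJ = p─q⊆p (N G J) (N G S) u∈Q
          u∉J , j , j∈J , a = ∈N⁻ u∈NJ
          from-S : u ∈ S → ⊥
          from-S u∈S = let j∉S , j∉NS = J-outside j∈J in ∉N[]⇒¬adj j∉S j∉NS u∈S (adj-sym a)
          from-N[S] : u ∈ N[ G ] S → ⊥
          from-N[S] u∈N[S] = [ from-S , x∈p─q⇒x∉q (N G J) (N G S) u∈Q ]′ (x∈p∪q⁻ S (N G S) u∈N[S])
      in [ from-N[S] , u∉J ]′ (x∈p∪q⁻ (N[ G ] S) J u∈)

    counting : ∣ S ∣ + ∣ N G S ∣ + ∣ J ∣ + ∣ Q ∣ ≤ 2 * (∣ S ∣ + ∣ J ∣)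
    counting = begin
      ∣ S ∣ + ∣ N G S ∣ + ∣ J ∣ + ∣ Q ∣ ≡⟨ cong (λ m → m + ∣ J ∣ + ∣ Q ∣)
                                               (∣p∪q∣≡∣p∣+∣q∣ S (N G S) S-NS-disjoint) ⟨
      ∣ N[ G ] S ∣ + ∣ J ∣ + ∣ Q ∣       ≡⟨ cong (_+ ∣ Q ∣)
                                               (∣p∪q∣≡∣p∣+∣q∣ (N[ G ] S) J N[S]-J-disjoint) ⟨
      ∣ N[ G ] S ∪ J ∣ + ∣ Q ∣           ≡⟨ ∣p∪q∣≡∣p∣+∣q∣ (N[ G ] S ∪ J) Q Q-disjoint ⟨
      ∣ (N[ G ] S ∪ J) ∪ Q ∣             ≤⟨ ∣p∣≤n ((N[ G ] S ∪ J) ∪ Q) ⟩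
      n                                 ≡⟨ half-order ⟩
      2 * (∣ S ∣ + ∣ J ∣)                 ∎
      where
      open ≤-Reasoning
      S-NS-disjoint : Disjoint S (N G S)
      S-NS-disjoint u∈S u∈NS = proj₁ (∈N⁻ u∈NS) u∈S
      N[S]-J-disjoint : Disjoint (N[ G ] S) J
      N[S]-J-disjoint u∈ u∈J = x∈∁p⇒x∉p (within J-ext u∈J) u∈

    boundary-bound : ∣ N G S ∣ ≤ ∣ S ∣
    boundary-bound = +-cancelˡ-≤ (∣ S ∣ + ∣ J ∣ + ∣ J ∣) (∣ N G S ∣) (∣ S ∣) (begin
      ∣ S ∣ + ∣ J ∣ + ∣ J ∣ + ∣ N G S ∣   ≡⟨ reorder (∣ S ∣) (∣ N G S ∣) (∣ J ∣) ⟩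
      ∣ S ∣ + ∣ N G S ∣ + ∣ J ∣ + ∣ J ∣   ≤⟨ +-monoʳ-≤ (∣ S ∣ + ∣ N G S ∣ + ∣ J ∣) J≤Q ⟩
      ∣ S ∣ + ∣ N G S ∣ + ∣ J ∣ + ∣ Q ∣   ≤⟨ counting ⟩
      2 * (∣ S ∣ + ∣ J ∣)                 ≡⟨ double (∣ S ∣) (∣ J ∣) ⟩
      ∣ S ∣ + ∣ J ∣ + ∣ J ∣ + ∣ S ∣       ∎)
      where
      open ≤-Reasoning
      reorder : ∀ s m j → s + j + j + m ≡ s + m + j + j
      reorder = solve-∀
      double : ∀ s j → 2 * (s + j) ≡ s + j + j + s
      double = solve-∀

localMax⇔ : ∀ {n} (G : Graph n) → VeryWellCovered G →
            ∀ {S} → Stable G S → (LocalMax G S ⇔ ∣ N G S ∣ ≡ ∣ S ∣)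
localMax⇔ G vwc {S} stS = mk⇔
  (λ lmS → ≤-antisym (Boundary.boundary-bound vwc lmS) (hall-ineq S stS))
  (λ |NS|≡|S| → small-boundary⇒localMax hall-ineq stS (≤-reflexive |NS|≡|S|))
  where
  open LocalMaxima G
  hall-ineq : ∀ X → Stable G X → ∣ X ∣ ≤ ∣ N G X ∣
  hall-ineq = hall G (proj₁ vwc) (proj₁ (proj₂ vwc))

lemma2 : ∀ (n : ℕ) (G : Graph n) → VeryWellCovered G →
         (B : Subset n) → LocalMax G B →
         (v : Fin n) → v ∉ B → Stable G (B ∪ ⁅ v ⁆) →
         (LocalMax G (B ∪ ⁅ v ⁆) ⇔ (∣ N G (B ∪ ⁅ v ⁆) ∣ ≡ suc ∣ N G B ∣))
lemma2 n G vwc B lmB v v∉B stA = mk⇔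
  (λ lmA → begin
    ∣ N G A ∣      ≡⟨ Equivalence.to A-characterised lmA ⟩
    ∣ A ∣          ≡⟨ ∣A∣≡1+∣B∣ ⟩
    suc ∣ B ∣      ≡⟨ cong suc ∣NB∣≡∣B∣ ⟨
    suc ∣ N G B ∣  ∎)
  (λ ∣NA∣≡1+∣NB∣ → Equivalence.from A-characterised (begin
    ∣ N G A ∣      ≡⟨ ∣NA∣≡1+∣NB∣ ⟩
    suc ∣ N G B ∣  ≡⟨ cong suc ∣NB∣≡∣B∣ ⟩
    suc ∣ B ∣      ≡⟨ ∣A∣≡1+∣B∣ ⟨
    ∣ A ∣          ∎))
  where
  open ≡-Reasoning
  A : Subset n
  A = B ∪ ⁅ v ⁆
  A-characterised : LocalMax G A ⇔ (∣ N G A ∣ ≡ ∣ A ∣)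
  A-characterised = localMax⇔ G vwc stA
  ∣NB∣≡∣B∣ : ∣ N G B ∣ ≡ ∣ B ∣
  ∣NB∣≡∣B∣ = Equivalence.to (localMax⇔ G vwc (proj₁ (proj₂ lmB))) lmB
  ∣A∣≡1+∣B∣ : ∣ A ∣ ≡ suc ∣ B ∣
  ∣A∣≡1+∣B∣ = ∣p∪⁅x⁆∣≡1+∣p∣ B v∉B
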